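{- Let $X$ be a finite or countable set with $|X|\ge 3$ and $\varphi$ a coloring on $X$. The following are equivalent: (i) there is a coloring $\psi$ on $X$ with $\mathrm{hom}(\varphi)=\mathrm{hom}(\psi)$ such that there is exactly one $\{x,y\}\in[X]^2$ with $\varphi(\{x,y\})\ne\psi(\{x,y\})$; (ii) there is a critical pair for $\varphi$. In particular, every coloring having a critical pair is not reconstructible.
   Context: A coloring on a set $X$ is a function $\varphi:[X]^2\to\{0,1\}$, where $[X]^2$ is the set of $2$-element subsets of $X$. $\mathrm{hom}(\varphi)=\{H\subseteq X:\ |H|>2 \text{ and } \varphi \text{ is constant on } [H]^2\}$. A pair $\{x,y\}\in[X]^2$ is critical for $\varphi$ if $\varphi(\{x,z\})=1-\varphi(\{y,z\})$ for all $z\in X\setminus\{x,y\}$. A coloring $\varphi$ on $X$ is reconstructible if for every coloring $\psi$ on $X$ with $\mathrm{hom}(\psi)=\mathrm{hom}(\varphi)$ one has $\psi=\varphi$ or $\psi=1-\varphi$. -}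

module Defs where

open import Data.Nat using (ℕ)
open import Data.Bool using (Bool; not)
open import Data.Product using (Σ; ∃; ∃-syntax; _×_; _,_)
open import Data.Sum using (_⊎_)
open import Relation.Nullary using (¬_)
open import Relation.Binary.PropositionalEquality using (_≡_; _≢_; cong)
open import Relation.Unary using (Pred; _∈_)
open import Level using (0ℓ)
open import Function.Definitions using (Injective)

FiniteOrCountable : Set → Set
FiniteOrCountable X = Σ (X → ℕ) λ f → Injective _≡_ _≡_ f

AtLeast3 : Set → Set
AtLeast3 X = Σ X λ a → Σ X λ b → Σ X λ c → (a ≢ b × a ≢ c × b ≢ c)

-- A coloring φ : [X]² → {0,1}, represented as a symmetric function
-- X → X → Bool; only its values on pairs x ≢ y are ever used.
record Coloring (X : Set) : Set where
  constructor mkColoring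
  field
    col : X → X → Bool
    sym : ∀ x y → col x y ≡ col y x
open Coloring public

compl : {X : Set} → Coloring X → Coloring X
compl φ = mkColoring (λ x y → not (col φ x y))
                     (λ x y → cong not (sym φ x y))

_≐_ : {X : Set} → Coloring X → Coloring X → Set
φ ≐ ψ = ∀ x y → x ≢ y → col φ x y ≡ col ψ x y

HasMoreThan2 : {X : Set} → Pred X 0ℓ → Set
HasMoreThan2 {X} H =
  ∃[ a ] ∃[ b ] ∃[ c ] (a ∈ H × b ∈ H × c ∈ H × a ≢ b × a ≢ c × b ≢ c)

ConstantOn : {X : Set} → Coloring X → Pred X 0ℓ → Set
ConstantOn {X} φ H = ∃[ i ] (∀ x y → x ∈ H → y ∈ H → x ≢ y → col φ x y ≡ i)

InHom : {X : Set} → Coloring X → Pred X 0ℓ → Set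
InHom φ H = HasMoreThan2 H × ConstantOn φ H

SameHom : {X : Set} → Coloring X → Coloring X → Set₁
SameHom {X} φ ψ = (H : Pred X 0ℓ) → (InHom φ H → InHom ψ H) × (InHom ψ H → InHom φ H)

Critical : {X : Set} → Coloring X → X → X → Set
Critical φ x y =
  x ≢ y × (∀ z → z ≢ x → z ≢ y → col φ x z ≡ not (col φ y z))

HasCriticalPair : {X : Set} → Coloring X → Set
HasCriticalPair φ = ∃[ x ] ∃[ y ] Critical φ x y

DifferOnExactlyOnePair : {X : Set} → Coloring X → Coloring X → Set
DifferOnExactlyOnePair φ ψ =
  ∃[ x ] ∃[ y ] (x ≢ y × col φ x y ≢ col ψ x y ×
    (∀ u v → u ≢ v → col φ u v ≢ col ψ u v →
       (u ≡ x × v ≡ y) ⊎ (u ≡ y × v ≡ x)))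

Reconstructible : {X : Set} → Coloring X → Set₁
Reconstructible {X} φ = (ψ : Coloring X) → SameHom ψ φ → (ψ ≐ φ) ⊎ (ψ ≐ compl φ)

module Submission where

open import Defs
open import Data.Bool using (Bool; not)
open import Data.Bool.Properties using (not-¬; ¬-not) renaming (_≟_ to _≟ᵇ_)
open import Data.Empty using (⊥; ⊥-elim)
open import Data.Nat.Properties using (eq?)
open import Data.Product using (_×_; ∃-syntax; _,_; proj₁; proj₂; swap)
open import Data.Sum using (_⊎_; inj₁; inj₂)
open import Function.Bundles using (_⇔_; mk⇔; mk↣)
open import Level using (0ℓ)
open import Relation.Binary.Definitions using (DecidableEquality)
open import Relation.Binary.PropositionalEquality
  using (_≡_; _≢_; refl; trans; cong; ≢-sym; module ≡-Reasoning) renaming (sym to ≡-sym)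
open import Relation.Nullary using (¬_; Dec; yes; no)
open import Relation.Nullary.Decidable using (_×-dec_; _⊎-dec_; decidable-stable)
open import Relation.Unary using (Pred; _∈_)

-- Flipping the colour of a critical pair {x,y} creates no new homogeneous
-- set and destroys none, because a homogeneous set with more than two
-- elements cannot contain both x and y: a third element z would get
-- φ{x,z} = φ{y,z}.  Conversely, if changing only φ{x,y} preserves hom(φ),
-- then for every other z the triangle {x,y,z} shows φ{x,z} ≠ φ{y,z}: if
-- φ{x,z} = φ{y,z}, the triangle is homogeneous for exactly one of the two
-- colorings, whichever gives {x,y} that common colour.

OnPair : {X : Set} → X → X → X → X → Set
OnPair x y u v = (u ≡ x × v ≡ y) ⊎ (u ≡ y × v ≡ x)

module _ {X : Set} {x y : X} where

  OnPair-swap : ∀ {u v} → OnPair x y u v → OnPair x y v u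
  OnPair-swap (inj₁ (u≡x , v≡y)) = inj₂ (v≡y , u≡x)
  OnPair-swap (inj₂ (u≡y , v≡x)) = inj₁ (v≡x , u≡y)

  ¬OnPair-left : ∀ {z} → x ≢ y → z ≢ y → ¬ OnPair x y x z
  ¬OnPair-left _   z≢y (inj₁ (_ , z≡y)) = z≢y z≡y
  ¬OnPair-left x≢y _   (inj₂ (x≡y , _)) = x≢y x≡y

  ¬OnPair-right : ∀ {z} → x ≢ y → z ≢ x → ¬ OnPair x y y z
  ¬OnPair-right x≢y _   (inj₁ (y≡x , _)) = x≢y (≡-sym y≡x)
  ¬OnPair-right _   z≢x (inj₂ (_ , z≡x)) = z≢x z≡x

triangle : {X : Set} → X → X → X → Pred X 0ℓ
triangle x y z w = w ≡ x ⊎ w ≡ y ⊎ w ≡ z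

module _ {X : Set} (α : Coloring X) {x y z : X} where

  triangle-InHom : x ≢ y → x ≢ z → y ≢ z → ∀ {i} →
    col α x y ≡ i → col α x z ≡ i → col α y z ≡ i → InHom α (triangle x y z)
  triangle-InHom x≢y x≢z y≢z {i} xy xz yz =
    (x , y , z , inj₁ refl , inj₂ (inj₁ refl) , inj₂ (inj₂ refl) , x≢y , x≢z , y≢z) , i , constant
    where
    constant : ∀ u v → u ∈ triangle x y z → v ∈ triangle x y z → u ≢ v → col α u v ≡ i
    constant _ _ (inj₁ refl)        (inj₁ refl)        u≢v = ⊥-elim (u≢v refl)
    constant _ _ (inj₁ refl)        (inj₂ (inj₁ refl)) _   = xy
    constant _ _ (inj₁ refl)        (inj₂ (inj₂ refl)) _   = xz
    constant _ _ (inj₂ (inj₁ refl)) (inj₁ refl)        _   = trans (sym α y x) xy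
    constant _ _ (inj₂ (inj₁ refl)) (inj₂ (inj₁ refl)) u≢v = ⊥-elim (u≢v refl)
    constant _ _ (inj₂ (inj₁ refl)) (inj₂ (inj₂ refl)) _   = yz
    constant _ _ (inj₂ (inj₂ refl)) (inj₁ refl)        _   = trans (sym α z x) xz
    constant _ _ (inj₂ (inj₂ refl)) (inj₂ (inj₁ refl)) _   = trans (sym α z y) yz
    constant _ _ (inj₂ (inj₂ refl)) (inj₂ (inj₂ refl)) u≢v = ⊥-elim (u≢v refl)

  triangle-¬InHom : x ≢ y → x ≢ z → col α x y ≢ col α x z → ¬ InHom α (triangle x y z)
  triangle-¬InHom x≢y x≢z xy≢xz (_ , i , constant) =
    xy≢xz (trans (constant x y (inj₁ refl) (inj₂ (inj₁ refl)) x≢y)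
                 (≡-sym (constant x z (inj₁ refl) (inj₂ (inj₂ refl)) x≢z)))

module _ {X : Set} (φ ψ : Coloring X) where

  agree-offPair : ∀ x y → (∀ u v → u ≢ v → col φ u v ≢ col ψ u v → OnPair x y u v) →
    ∀ {u v} → u ≢ v → ¬ OnPair x y u v → col φ u v ≡ col ψ u v
  agree-offPair x y only {u} {v} u≢v ¬onPair =
    decidable-stable (col φ u v ≟ᵇ col ψ u v) (λ differ → ¬onPair (only u v u≢v differ))

  SameHom∧DifferOnExactlyOnePair⇒HasCriticalPair :
    SameHom φ ψ → DifferOnExactlyOnePair φ ψ → HasCriticalPair φ
  SameHom∧DifferOnExactlyOnePair⇒HasCriticalPair sameHom (x , y , x≢y , φ≢ψ , only) =
    x , y , x≢y , λ z z≢x z≢y → ¬-not (separated (≢-sym z≢x) (≢-sym z≢y))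
    where
    agree-xz : ∀ {z} → x ≢ z → y ≢ z → col φ x z ≡ col ψ x z
    agree-xz x≢z y≢z = agree-offPair x y only x≢z (¬OnPair-left x≢y (≢-sym y≢z))

    agree-yz : ∀ {z} → x ≢ z → y ≢ z → col φ y z ≡ col ψ y z
    agree-yz x≢z y≢z = agree-offPair x y only y≢z (¬OnPair-right x≢y (≢-sym x≢z))

    separated : ∀ {z} → x ≢ z → y ≢ z → col φ x z ≢ col φ y z
    separated {z} x≢z y≢z xz≡yz with col φ x y ≟ᵇ col φ x z
    ... | yes xy≡xz =
      triangle-¬InHom ψ x≢y x≢z
        (λ ψxy≡ψxz → φ≢ψ (trans xy≡xz (trans (agree-xz x≢z y≢z) (≡-sym ψxy≡ψxz))))
        (proj₁ (sameHom (triangle x y z))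
          (triangle-InHom φ x≢y x≢z y≢z xy≡xz refl (≡-sym xz≡yz)))
    ... | no xy≢xz =
      triangle-¬InHom φ x≢y x≢z xy≢xz
        (proj₂ (sameHom (triangle x y z))
          (triangle-InHom ψ x≢y x≢z y≢z ψxy≡φxz (≡-sym (agree-xz x≢z y≢z))
            (trans (≡-sym (agree-yz x≢z y≢z)) (≡-sym xz≡yz))))
      where
      ψxy≡φxz : col ψ x y ≡ col φ x z
      ψxy≡φxz = trans (¬-not (≢-sym φ≢ψ)) (≡-sym (¬-not (≢-sym xy≢xz)))

  DifferOnExactlyOnePair⇒¬≐ : DifferOnExactlyOnePair φ ψ → ¬ (ψ ≐ φ)
  DifferOnExactlyOnePair⇒¬≐ (x , y , x≢y , differ , _) ψ≐φ =
    differ (≡-sym (ψ≐φ x y x≢y))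

  ≐compl⇒differ : ψ ≐ compl φ → ∀ {u v} → u ≢ v → col φ u v ≢ col ψ u v
  ≐compl⇒differ ψ≐¬φ {u} {v} u≢v φ≡ψ = not-¬ refl (trans φ≡ψ (ψ≐¬φ u v u≢v))

  -- Two distinct pairs {a,b} and {a,c} cannot both be the unique pair {x,y}.
  DifferOnExactlyOnePair⇒¬≐compl :
    AtLeast3 X → DifferOnExactlyOnePair φ ψ → ¬ (ψ ≐ compl φ)
  DifferOnExactlyOnePair⇒¬≐compl (a , b , c , a≢b , a≢c , b≢c) (_ , _ , _ , _ , only) ψ≐¬φ
    with only a b a≢b (≐compl⇒differ ψ≐¬φ a≢b)
       | only a c a≢c (≐compl⇒differ ψ≐¬φ a≢c)
  ... | inj₁ (refl , refl) | inj₁ (_ , refl) = b≢c refl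
  ... | inj₁ (refl , _)    | inj₂ (_ , refl) = a≢c refl
  ... | inj₂ (refl , _)    | inj₁ (_ , refl) = a≢c refl
  ... | inj₂ (refl , refl) | inj₂ (_ , refl) = b≢c refl

  SameHom∧DifferOnExactlyOnePair⇒¬Reconstructible :
    AtLeast3 X → SameHom φ ψ → DifferOnExactlyOnePair φ ψ → ¬ Reconstructible φ
  SameHom∧DifferOnExactlyOnePair⇒¬Reconstructible atLeast3 sameHom differ reconstructible
    with reconstructible ψ (λ H → swap (sameHom H))
  ... | inj₁ ψ≐φ      = DifferOnExactlyOnePair⇒¬≐ differ ψ≐φ
  ... | inj₂ ψ≐complφ = DifferOnExactlyOnePair⇒¬≐compl atLeast3 differ ψ≐complφ

module _ {X : Set} (_≟_ : DecidableEquality X) where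

  OnPair? : ∀ x y u v → Dec (OnPair x y u v)
  OnPair? x y u v = ((u ≟ x) ×-dec (v ≟ y)) ⊎-dec ((u ≟ y) ×-dec (v ≟ x))

  thirdPoint : (H : Pred X 0ℓ) → HasMoreThan2 H → ∀ x y → ∃[ z ] (z ∈ H × z ≢ x × z ≢ y)
  thirdPoint H (a , b , c , a∈H , b∈H , c∈H , a≢b , a≢c , b≢c) x y with a ≟ x | a ≟ y
  ... | no a≢x | no a≢y = a , a∈H , a≢x , a≢y
  ... | yes refl | _ with b ≟ y
  ...   | no b≢y   = b , b∈H , ≢-sym a≢b , b≢y
  ...   | yes refl = c , c∈H , ≢-sym a≢c , ≢-sym b≢c
  thirdPoint H (a , b , c , a∈H , b∈H , c∈H , a≢b , a≢c , b≢c) x y | no _ | yes refl with b ≟ x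
  ...   | no b≢x   = b , b∈H , b≢x , ≢-sym a≢b
  ...   | yes refl = c , c∈H , ≢-sym b≢c , ≢-sym a≢c

  critical-¬bothInHom : (α : Coloring X) → ∀ {x y} → Critical α x y →
    ∀ {H} → InHom α H → x ∈ H → y ∈ H → ⊥
  critical-¬bothInHom α {x} {y} (_ , crit) {H} (moreThan2 , i , constant) x∈H y∈H
    with thirdPoint H moreThan2 x y
  ... | z , z∈H , z≢x , z≢y =
    not-¬ (trans (constant x z x∈H z∈H (≢-sym z≢x))
                 (≡-sym (constant y z y∈H z∈H (≢-sym z≢y))))
          (crit z z≢x z≢y)

  InHom-transfer : (α β : Coloring X) → ∀ {x y} → Critical α x y →
    (∀ u v → ¬ OnPair x y u v → col α u v ≡ col β u v) → ∀ {H} → InHom α H → InHom β H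
  InHom-transfer α β {x} {y} critical agree {H} hom@(moreThan2 , i , constant) =
    moreThan2 , i , constantβ
    where
    constantβ : ∀ u v → u ∈ H → v ∈ H → u ≢ v → col β u v ≡ i
    constantβ u v u∈H v∈H u≢v with OnPair? x y u v
    ... | no ¬onPair = trans (≡-sym (agree u v ¬onPair)) (constant u v u∈H v∈H u≢v)
    ... | yes (inj₁ (refl , refl)) = ⊥-elim (critical-¬bothInHom α critical hom u∈H v∈H)
    ... | yes (inj₂ (refl , refl)) = ⊥-elim (critical-¬bothInHom α critical hom v∈H u∈H)

  module _ (x y : X) (φ : Coloring X) where

    flipCol : X → X → Bool
    flipCol u v with OnPair? x y u v
    ... | yes _ = not (col φ u v)
    ... | no _  = col φ u v

    flipCol-sym : ∀ u v → flipCol u v ≡ flipCol v u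
    flipCol-sym u v with OnPair? x y u v | OnPair? x y v u
    ... | yes _      | yes _      = cong not (sym φ u v)
    ... | no _       | no _       = sym φ u v
    ... | yes onPair | no ¬onPair = ⊥-elim (¬onPair (OnPair-swap onPair))
    ... | no ¬onPair | yes onPair = ⊥-elim (¬onPair (OnPair-swap onPair))

    flipAt : Coloring X
    flipAt = mkColoring flipCol flipCol-sym

    flipAt-onPair : ∀ {u v} → OnPair x y u v → col flipAt u v ≡ not (col φ u v)
    flipAt-onPair {u} {v} onPair with OnPair? x y u v
    ... | yes _       = refl
    ... | no ¬onPair  = ⊥-elim (¬onPair onPair)

    flipAt-offPair : ∀ u v → ¬ OnPair x y u v → col flipAt u v ≡ col φ u v
    flipAt-offPair u v ¬onPair with OnPair? x y u v
    ... | yes onPair = ⊥-elim (¬onPair onPair)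
    ... | no _       = refl

    flipAt-differsOnlyOnPair : x ≢ y → DifferOnExactlyOnePair φ flipAt
    flipAt-differsOnlyOnPair x≢y =
      x , y , x≢y , (λ eq → not-¬ refl (trans eq (flipAt-onPair (inj₁ (refl , refl))))) ,
      λ u v _ differ → decidable-stable (OnPair? x y u v)
                         (λ ¬onPair → differ (≡-sym (flipAt-offPair u v ¬onPair)))

    flipAt-critical : Critical φ x y → Critical flipAt x y
    flipAt-critical (x≢y , crit) = x≢y , λ z z≢x z≢y → begin
      col flipAt x z      ≡⟨ flipAt-offPair x z (¬OnPair-left x≢y z≢y) ⟩
      col φ x z           ≡⟨ crit z z≢x z≢y ⟩
      not (col φ y z)     ≡⟨ cong not (≡-sym (flipAt-offPair y z (¬OnPair-right x≢y z≢x))) ⟩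
      not (col flipAt y z) ∎
      where open ≡-Reasoning

    flipAt-SameHom : Critical φ x y → SameHom φ flipAt
    flipAt-SameHom critical H =
      InHom-transfer φ flipAt critical (λ u v ¬onPair → ≡-sym (flipAt-offPair u v ¬onPair)) ,
      InHom-transfer flipAt φ (flipAt-critical critical) flipAt-offPair

  HasCriticalPair⇒SameHom∧DifferOnExactlyOnePair : (φ : Coloring X) → HasCriticalPair φ →
    ∃[ ψ ] (SameHom φ ψ × DifferOnExactlyOnePair φ ψ)
  HasCriticalPair⇒SameHom∧DifferOnExactlyOnePair φ (x , y , critical) =
    flipAt x y φ , flipAt-SameHom x y φ critical , flipAt-differsOnlyOnPair x y φ (proj₁ critical)

mainTheorem5 : (X : Set) → FiniteOrCountable X → AtLeast3 X → (φ : Coloring X) →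
    ((∃[ ψ ] (SameHom φ ψ × DifferOnExactlyOnePair φ ψ)) ⇔ HasCriticalPair φ)
    × (HasCriticalPair φ → ¬ Reconstructible φ)
mainTheorem5 X (code , code-injective) atLeast3 φ = mk⇔ necessary sufficient , notReconstructible
  where
  _≟_ : DecidableEquality X
  _≟_ = eq? (mk↣ code-injective)

  necessary : ∃[ ψ ] (SameHom φ ψ × DifferOnExactlyOnePair φ ψ) → HasCriticalPair φ
  necessary (ψ , sameHom , differ) =
    SameHom∧DifferOnExactlyOnePair⇒HasCriticalPair φ ψ sameHom differ

  sufficient : HasCriticalPair φ → ∃[ ψ ] (SameHom φ ψ × DifferOnExactlyOnePair φ ψ)
  sufficient = HasCriticalPair⇒SameHom∧DifferOnExactlyOnePair _≟_ φ

  notReconstructible : HasCriticalPair φ → ¬ Reconstructible φ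
  notReconstructible critical with sufficient critical
  ... | ψ , sameHom , differ =
    SameHom∧DifferOnExactlyOnePair⇒¬Reconstructible φ ψ atLeast3 sameHom differ
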